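{- Let $G$ be a graph and let $t \ge 2$ and $k \ge 0$ be integers. Let $\mathcal{F}$ be the family containing the set $E_X$ for every clique $X$ of size $t$ in $G$. Consider the following rule (R1): if there is an edge $(x,y) \in E(G)$ such that $|\mathcal{F}_{xy}| > 2\cdot(t-2)!\cdot k^{t-2}$, where $\mathcal{F}_{xy} = \{X \subseteq V(G)\setminus\{x,y\} : E_{X\cup\{x,y\}} \in \mathcal{F}\}$ is computed with respect to the current family $\mathcal{F}$, find a sunflower $X_1,\ldots,X_{k+1}$ in $\mathcal{F}_{xy}$ with core $Y$, remove from $\mathcal{F}$ every $E_Z \in \mathcal{F}$ with $Y \cup\{x,y\} \subseteq Z$, and add $E_{Y\cup\{x,y\}}$ to $\mathcal{F}$. Let $\mathcal{F}'$ be the family obtained by applying (R1) repeatedly until it is not applicable. If $|\mathcal{F}'| > 2\cdot(t-2)!\cdot k^{t-1}$, then $\mathcal{F}'$ has no hitting set of size at most $k$.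
   Context: For a set of vertices $X$, $E_X$ denotes the set of all pairs $(x,y)$ with $x,y \in X$, $x\neq y$. A set $S$ is a hitting set of a family $\mathcal{F}$ if $S \cap F \neq \emptyset$ for every $F \in \mathcal{F}$. Distinct sets $S_1,\ldots,S_p$ form a sunflower with core $Y$ if $S_i \cap S_j = Y$ for all $i\neq j$ and $S_i\setminus Y \neq \emptyset$ for every $i$. (By the sunflower lemma, whenever $|\mathcal{F}_{xy}| > 2\cdot(t-2)!\cdot k^{t-2}$ such a sunflower with $k+1$ sets exists, since all sets in $\mathcal{F}_{xy}$ have size at most $t-2$.) -}

module Defs where

open import Data.Nat using (ℕ; zero; suc; _+_; _*_; _∸_; _^_; _≤_; _<_; _!)

open import Data.Bool using (Bool; true; false; _∧_; _∨_; not; T)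
open import Data.Bool.Properties using () renaming (_≟_ to _≟ᵇ_)
open import Data.Fin using (Fin)
open import Data.Fin.Subset using (Subset; _∈_; _∉_; _⊆_; _∪_; _∩_; ⁅_⁆; ∣_∣)
open import Data.Fin.Subset.Properties using (_⊆?_; _∈?_)
open import Data.Vec using (Vec; []; _∷_)
open import Data.Vec.Properties using (≡-dec)
open import Data.List using (List; []; _∷_; _++_; map; filter; length)
open import Data.List.Membership.Propositional using () renaming (_∈_ to _∈ˡ_)
open import Data.Product using (Σ; ∃; _×_; _,_)
open import Relation.Nullary using (¬_; Dec; yes; no)
open import Relation.Nullary.Decidable using (⌊_⌋)
open import Relation.Binary.PropositionalEquality using (_≡_; _≢_)
open import Relation.Binary.Construct.Closure.ReflexiveTransitive using (Star)
open import Function.Bundles using (_⇔_)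

record Graph (n : ℕ) : Set₁ where
  field
    Adj   : Fin n → Fin n → Set
    sym   : ∀ {u v} → Adj u v → Adj v u
    irrefl : ∀ {u} → ¬ Adj u u
open Graph public

IsClique : ∀ {n} → Graph n → Subset n → Set
IsClique G X = ∀ u v → u ∈ X → v ∈ X → u ≢ v → Adj G u v

E : ∀ {n} → Subset n → Fin n × Fin n → Set
E X (u , v) = u ∈ X × v ∈ X × u ≢ v

-- A family 𝓕 = { E_Z : Fam Z ≡ true } is represented by the (decidable)
-- set of vertex sets Z with E_Z ∈ 𝓕.  (Z ↦ E_Z is injective on |Z| ≥ 2,
-- which is the case for all sets that ever occur.)
Fam : ℕ → Set
Fam n = Subset n → Bool

allSubsets : ∀ n → List (Subset n)
allSubsets zero    = [] ∷ []
allSubsets (suc n) = map (true ∷_) (allSubsets n) ++ map (false ∷_) (allSubsets n)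

count : ∀ {n} → Fam n → ℕ
count {n} P = length (filter (λ Z → T? (P Z)) (allSubsets n))
  where
    T? : (b : Bool) → Dec (T b)
    T? true  = yes _
    T? false = no (λ ())

card : ∀ {n} → Fam n → ℕ
card = count

Fxy : ∀ {n} → Fam n → Fin n → Fin n → Fam n
Fxy F x y X = not ⌊ x ∈? X ⌋ ∧ not ⌊ y ∈? X ⌋ ∧ F (X ∪ (⁅ x ⁆ ∪ ⁅ y ⁆))

bound : ℕ → ℕ → ℕ
bound t k = 2 * (t ∸ 2) ! * k ^ (t ∸ 2)

Sunflower : ∀ {n m} → Fam n → (Fin m → Subset n) → Subset n → Set
Sunflower P Xs Y =
  (∀ i → T (P (Xs i))) ×
  (∀ i j → i ≢ j → Xs i ≢ Xs j) ×
  (∀ i j → i ≢ j → (Xs i ∩ Xs j) ≡ Y) ×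
  (∀ i → ∃ λ v → v ∈ Xs i × v ∉ Y)

update : ∀ {n} → Fam n → Subset n → Fam n
update F W Z = (F Z ∧ not ⌊ W ⊆? Z ⌋) ∨ ⌊ ≡-dec _≟ᵇ_ Z W ⌋

data R1 {n : ℕ} (G : Graph n) (t k : ℕ) : Fam n → Fam n → Set where
  step : ∀ {F} (x y : Fin n) → Adj G x y →
         bound t k < count (Fxy F x y) →
         (Xs : Fin (suc k) → Subset n) (Y : Subset n) →
         Sunflower (Fxy F x y) Xs Y →
         R1 G t k F (update F (Y ∪ (⁅ x ⁆ ∪ ⁅ y ⁆)))

R1-inapplicable : ∀ {n} → Graph n → ℕ → ℕ → Fam n → Set
R1-inapplicable G t k F = ∀ x y → Adj G x y → count (Fxy F x y) ≤ bound t k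

HittingSet : ∀ {n} → List (Fin n × Fin n) → Fam n → Set
HittingSet S F = ∀ Z → T (F Z) → ∃ λ e → e ∈ˡ S × E Z e

CliqueFamily : ∀ {n} → Graph n → ℕ → Fam n → Set
CliqueFamily G t F = ∀ Z → T (F Z) ⇔ (IsClique G Z × ∣ Z ∣ ≡ t)

module Submission where

-- Every set added by (R1) is the core Y of a sunflower in 𝓕_xy
-- together with x and y, hence lies inside X₁ ∪ {x,y} for a petal X₁; so by
-- induction along the run every member of 𝓕' is a clique of G (this needs
-- two petals, i.e. k ≥ 1; for k = 0 a hitting set of size ≤ k is empty).
-- Now let S be a hitting set with |S| ≤ k.  Every member Z of 𝓕' contains
-- some pair (u,v) ∈ S with u ≠ v; as Z is a clique, uv is an edge of G.
-- Removing u and v maps the members containing {u,v} injectively into 𝓕'_uv,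
-- and since (R1) is inapplicable there are at most 2·(t-2)!·k^(t-2) of them.
-- Summing over the at most k pairs of S gives |𝓕'| ≤ 2·(t-2)!·k^(t-1).

open import Defs hiding (sym)
open import Data.Nat using (ℕ; zero; suc; _+_; _*_; _∸_; _^_; _≤_; _<_; _!; z≤n; s≤s)
open import Data.Nat.Properties
  using (≤-refl; ≤-reflexive; ≤-trans; +-mono-≤; *-monoˡ-≤; +-identityʳ; m≤n+m; <⇒≱; module ≤-Reasoning; +-commutativeSemigroup)
open import Algebra.Properties.CommutativeSemigroup +-commutativeSemigroup using (interchange)
open import Data.Nat.Tactic.RingSolver using (solve-∀)
open import Data.Bool using (Bool; true; false; _∧_; _∨_; not; T)
open import Data.Bool.Properties using (T-∧; T-∨)
open import Data.Fin using (Fin; _≟_)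
import Data.Fin as Fin
open import Data.Fin.Subset using (Subset; inside; outside; _∈_; _∉_; _⊆_; _∪_; ⁅_⁆)
open import Data.Fin.Subset.Properties using (_⊆?_; _∈?_; x∈⁅x⁆; x∈⁅y⁆⇒x≡y; x∈p∪q⁻; p⊆p∪q; q⊆p∪q; p∩q⊆p)
open import Data.Vec using ([]; _∷_; here; there)
open import Data.List using (List; []; _∷_; map; filter; length)
open import Data.Bool.ListAction using (any)
open import Data.List.Properties using (filter-++; length-++)
open import Data.List.Relation.Unary.All using (All; []; _∷_; tabulate)
import Data.List.Relation.Unary.Any as Any
open import Data.List.Relation.Unary.Any.Properties using (any⁺)
open import Data.Product using (∃; _×_; _,_; proj₁; proj₂)
open import Data.Empty using (⊥-elim)
open import Level using (0ℓ)
open import Data.Sum using (_⊎_; inj₁; inj₂)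
open import Function using (_∘_; id)
open import Function.Bundles using (Equivalence)
open import Relation.Nullary using (¬_; yes; no; does; contradiction)
open import Relation.Nullary.Decidable using (⌊_⌋; toWitness; toWitnessFalse; fromWitnessFalse)
open import Relation.Unary using (Pred; Decidable)
open import Relation.Binary.PropositionalEquality using (_≡_; _≢_; refl; sym; trans; cong; cong₂; subst)
open import Relation.Binary.Construct.Closure.ReflexiveTransitive using (Star; fold)

open Equivalence using (to; from)

open ≤-Reasoning

filter-map-length : ∀ {A B : Set} {P : Pred A 0ℓ} (P? : Decidable P) (f : B → A) (xs : List B) →
                    length (filter P? (map f xs)) ≡ length (filter (P? ∘ f) xs)
filter-map-length P? f []       = refl
filter-map-length P? f (x ∷ xs) with P? (f x)
... | yes _ = cong suc (filter-map-length P? f xs)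
... | no  _ = filter-map-length P? f xs

filter-nonempty : ∀ {A : Set} {P : Pred A 0ℓ} (P? : Decidable P) (xs : List A) →
                  0 < length (filter P? xs) → ∃ P
filter-nonempty P? (x ∷ xs) pos with P? x
... | yes px = x , px
... | no  _  = filter-nonempty P? xs pos

-- |𝓕| splits according to whether the first vertex belongs to the member:
-- 'allSubsets (suc n)' lists the sets containing it, then those avoiding it.
count-split : ∀ {n} (F : Fam (suc n)) →
              count F ≡ count (λ Z → F (inside ∷ Z)) + count (λ Z → F (outside ∷ Z))
count-split {n} F =
  trans (cong length (filter-++ _ (map (inside ∷_) (allSubsets n)) _))
  (trans (length-++ (filter _ (map (inside ∷_) (allSubsets n))))
         (cong₂ _+_ (filter-map-length _ _ (allSubsets n)) (filter-map-length _ _ (allSubsets n))))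

count-mono : ∀ {n} (F F' : Fam n) → (∀ Z → T (F Z) → T (F' Z)) → count F ≤ count F'
count-mono {zero} F F' F⊆F' with F [] | F' [] | F⊆F' []
... | true  | true  | _ = ≤-refl
... | true  | false | h = ⊥-elim (h _)
... | false | _     | _ = z≤n
count-mono {suc n} F F' F⊆F' = begin
  count F                                                        ≡⟨ count-split F ⟩
  count (λ Z → F (inside ∷ Z)) + count (λ Z → F (outside ∷ Z))
    ≤⟨ +-mono-≤ (count-mono _ _ (λ Z → F⊆F' (inside ∷ Z))) (count-mono _ _ (λ Z → F⊆F' (outside ∷ Z))) ⟩
  count (λ Z → F' (inside ∷ Z)) + count (λ Z → F' (outside ∷ Z)) ≡⟨ count-split F' ⟨
  count F'                                                       ∎

count-empty : ∀ {n} (F : Fam n) → (∀ Z → ¬ T (F Z)) → count F ≡ 0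
count-empty {zero} F empty with F [] | empty []
... | true  | ¬m = ⊥-elim (¬m _)
... | false | _  = refl
count-empty {suc n} F empty = begin-equality
  count F                                                        ≡⟨ count-split F ⟩
  count (λ Z → F (inside ∷ Z)) + count (λ Z → F (outside ∷ Z))
    ≡⟨ cong₂ _+_ (count-empty _ (λ Z → empty (inside ∷ Z))) (count-empty _ (λ Z → empty (outside ∷ Z))) ⟩
  0                                                              ∎

count-∨ : ∀ {n} (F F' : Fam n) → count (λ Z → F Z ∨ F' Z) ≤ count F + count F'
count-∨ {zero} F F' with F [] | F' []
... | true  | true  = s≤s z≤n
... | true  | false = ≤-refl
... | false | true  = ≤-refl
... | false | false = z≤n
count-∨ {suc n} F F' = begin
  count (λ Z → F Z ∨ F' Z)                        ≡⟨ count-split (λ Z → F Z ∨ F' Z) ⟩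
  count (λ Z → F₁ Z ∨ F'₁ Z) + count (λ Z → F₀ Z ∨ F'₀ Z)
    ≤⟨ +-mono-≤ (count-∨ F₁ F'₁) (count-∨ F₀ F'₀) ⟩
  (count F₁ + count F'₁) + (count F₀ + count F'₀) ≡⟨ interchange (count F₁) (count F'₁) (count F₀) (count F'₀) ⟩
  (count F₁ + count F₀) + (count F'₁ + count F'₀) ≡⟨ cong₂ _+_ (count-split F) (count-split F') ⟨
  count F + count F'                              ∎
  where
  F₁ F₀ F'₁ F'₀ : Fam n
  F₁  Z = F (inside ∷ Z)
  F₀  Z = F (outside ∷ Z)
  F'₁ Z = F' (inside ∷ Z)
  F'₀ Z = F' (outside ∷ Z)

count-cases : ∀ {n} (F : Fam n) {b : ℕ} → ((∃ λ Z → T (F Z)) → count F ≤ b) → count F ≤ b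
count-cases F bounded with count F in eq
... | zero  = z≤n
... | suc _ = bounded (filter-nonempty _ (allSubsets _) (subst (0 <_) (sym eq) (s≤s z≤n)))

disjoint : ∀ {n} → Subset n → Subset n → Bool
disjoint []      []      = true
disjoint (b ∷ X) (c ∷ W) = not (b ∧ c) ∧ disjoint X W

disjoint⇒∉ : ∀ {n} (X W : Subset n) {u : Fin n} → T (disjoint X W) → u ∈ W → u ∉ X
disjoint⇒∉ (true  ∷ X) (true  ∷ W) () here         _
disjoint⇒∉ (false ∷ X) (true  ∷ W) _  here         ()
disjoint⇒∉ (true  ∷ X) (true  ∷ W) () (there u∈W)  _
disjoint⇒∉ (b     ∷ X) (false ∷ W) d  (there u∈W)  (there u∈X) = disjoint⇒∉ X W (proj₂ (to T-∧ d)) u∈W u∈X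
disjoint⇒∉ (false ∷ X) (true  ∷ W) d  (there u∈W)  (there u∈X) = disjoint⇒∉ X W d u∈W u∈X

-- The members of 𝓕 containing W.  ('does' rather than '⌊_⌋' so that the
-- test computes vertex by vertex, as 'containing≤link' below requires.)
containing : ∀ {n} → Fam n → Subset n → Fam n
containing F W Z = does (W ⊆? Z) ∧ F Z

containing⁺ : ∀ {n} (F : Fam n) (W Z : Subset n) → W ⊆ Z → T (F Z) → T (containing F W Z)
containing⁺ F W Z W⊆Z m with W ⊆? Z
... | yes _   = m
... | no W⊈Z = contradiction (λ {x} → W⊆Z {x}) W⊈Z

containing⁻ : ∀ {n} (F : Fam n) (W Z : Subset n) → T (containing F W Z) → W ⊆ Z × T (F Z)
containing⁻ F W Z m with W ⊆? Z
... | yes W⊆Z = W⊆Z , m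

link : ∀ {n} → Fam n → Subset n → Fam n
link F W X = disjoint X W ∧ F (X ∪ W)

-- Z ↦ Z ∖ W maps the members containing W injectively into the link of W;
-- proved by splitting off the first vertex.
containing≤link : ∀ {n} (F : Fam n) (W : Subset n) → count (containing F W) ≤ count (link F W)
containing≤link {zero}  F []           = count-mono (containing F []) (link F []) λ { [] m → m }
containing≤link {suc n} F (inside ∷ W) = begin
  count (containing F (inside ∷ W))                  ≡⟨ count-split (containing F (inside ∷ W)) ⟩
  count (containing F₁ W) + count {n} (λ _ → false)  ≡⟨ cong (count (containing F₁ W) +_) nothing-avoids-W ⟩
  count (containing F₁ W) + 0                        ≡⟨ +-identityʳ _ ⟩
  count (containing F₁ W)                            ≤⟨ containing≤link F₁ W ⟩
  count (link F₁ W)                                  ≤⟨ m≤n+m _ _ ⟩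
  count {n} (λ _ → false) + count (link F₁ W)        ≡⟨ count-split (link F (inside ∷ W)) ⟨
  count (link F (inside ∷ W))                        ∎
  where
  F₁ : Fam n
  F₁ Z = F (inside ∷ Z)
  -- No member avoiding the first vertex contains W, and no set containing
  -- it is disjoint from W.
  nothing-avoids-W : count {n} (λ _ → false) ≡ 0
  nothing-avoids-W = count-empty {n} (λ _ → false) λ _ ()
containing≤link {suc n} F (outside ∷ W) = begin
  count (containing F (outside ∷ W))                  ≡⟨ count-split (containing F (outside ∷ W)) ⟩
  count (containing F₁ W) + count (containing F₀ W)   ≤⟨ +-mono-≤ (containing≤link F₁ W) (containing≤link F₀ W) ⟩
  count (link F₁ W) + count (link F₀ W)               ≡⟨ count-split (link F (outside ∷ W)) ⟨
  count (link F (outside ∷ W))                        ∎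
  where
  F₁ F₀ : Fam n
  F₁ Z = F (inside ∷ Z)
  F₀ Z = F (outside ∷ Z)

pairSet : ∀ {n} → Fin n → Fin n → Subset n
pairSet u v = ⁅ u ⁆ ∪ ⁅ v ⁆

u∈pairSet : ∀ {n} (u v : Fin n) → u ∈ pairSet u v
u∈pairSet u v = p⊆p∪q ⁅ v ⁆ (x∈⁅x⁆ u)

v∈pairSet : ∀ {n} (u v : Fin n) → v ∈ pairSet u v
v∈pairSet u v = q⊆p∪q ⁅ u ⁆ ⁅ v ⁆ (x∈⁅x⁆ v)

pairSet⊆ : ∀ {n} {u v : Fin n} {Z : Subset n} → u ∈ Z → v ∈ Z → pairSet u v ⊆ Z
pairSet⊆ {u = u} {v} {Z} u∈Z v∈Z w∈uv with x∈p∪q⁻ ⁅ u ⁆ ⁅ v ⁆ w∈uv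
... | inj₁ w∈u = subst (_∈ Z) (sym (x∈⁅y⁆⇒x≡y u w∈u)) u∈Z
... | inj₂ w∈v = subst (_∈ Z) (sym (x∈⁅y⁆⇒x≡y v w∈v)) v∈Z

link⊆Fxy : ∀ {n} (F : Fam n) (x y : Fin n) (X : Subset n) → T (link F (pairSet x y) X) → T (Fxy F x y X)
link⊆Fxy F x y X l =
  from T-∧ (fromWitnessFalse {a? = x ∈? X} (missing (u∈pairSet x y)) ,
            from T-∧ (fromWitnessFalse {a? = y ∈? X} (missing (v∈pairSet x y)) , member))
  where
  missing : ∀ {u} → u ∈ pairSet x y → u ∉ X
  missing = disjoint⇒∉ X (pairSet x y) (proj₁ (to T-∧ l))
  member : T (F (X ∪ pairSet x y))
  member = proj₂ (to T-∧ l)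

CliqueMembers : ∀ {n} → Graph n → Fam n → Set
CliqueMembers G F = ∀ Z → T (F Z) → IsClique G Z

clique-⊆ : ∀ {n} (G : Graph n) {A B : Subset n} → A ⊆ B → IsClique G B → IsClique G A
clique-⊆ G A⊆B clique u v u∈A v∈A u≢v = clique u v (A⊆B u∈A) (A⊆B v∈A) u≢v

update⁻ : ∀ {n} (F : Fam n) (W Z : Subset n) → T (update F W Z) → T (F Z) ⊎ Z ≡ W
update⁻ F W Z m with to T-∨ m
... | inj₁ kept  = inj₁ (proj₁ (to T-∧ kept))
... | inj₂ added = inj₂ (toWitness added)

-- With at least two petals the core lies in every petal, here the first.
core⊆petal : ∀ {n m} {P : Fam n} {Xs : Fin (suc (suc m)) → Subset n} {Y : Subset n} →
             Sunflower P Xs Y → Y ⊆ Xs Fin.zero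
core⊆petal {Xs = Xs} (_ , _ , core , _) y∈Y =
  p∩q⊆p (Xs Fin.zero) (Xs (Fin.suc Fin.zero)) (subst (_ ∈_) (sym (core Fin.zero (Fin.suc Fin.zero) λ ())) y∈Y)

Fxy⁻ : ∀ {n} (F : Fam n) (x y : Fin n) (X : Subset n) → T (Fxy F x y X) → T (F (X ∪ pairSet x y))
Fxy⁻ F x y X m =
  proj₂ (to (T-∧ {not ⌊ y ∈? X ⌋}) (proj₂ (to (T-∧ {not ⌊ x ∈? X ⌋}) m)))

-- An (R1) step with at least two petals adds Y ∪ {x,y} ⊆ X₁ ∪ {x,y}, a
-- subset of a member, and so keeps every member a clique.
R1-preserves-cliques : ∀ {n} {G : Graph n} {t k : ℕ} {F F' : Fam n} →
                       R1 G t (suc k) F F' → CliqueMembers G F → CliqueMembers G F'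
R1-preserves-cliques {G = G} {F = F} (step x y _ _ Xs Y sunflower) cliques Z m
  with update⁻ F (Y ∪ pairSet x y) Z m
... | inj₁ kept = cliques Z kept
... | inj₂ refl = clique-⊆ G added⊆petal (cliques _ (Fxy⁻ F x y (Xs Fin.zero) (proj₁ sunflower Fin.zero)))
  where
  added⊆petal : Y ∪ pairSet x y ⊆ Xs Fin.zero ∪ pairSet x y
  added⊆petal w∈added with x∈p∪q⁻ Y (pairSet x y) w∈added
  ... | inj₁ w∈Y  = p⊆p∪q (pairSet x y) (core⊆petal {P = Fxy F x y} sunflower w∈Y)
  ... | inj₂ w∈xy = q⊆p∪q (Xs Fin.zero) (pairSet x y) w∈xy

run-preserves-cliques : ∀ {n} {G : Graph n} {t k : ℕ} {F F' : Fam n} →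
                        Star (R1 G t (suc k)) F F' → CliqueMembers G F → CliqueMembers G F'
run-preserves-cliques {G = G} =
  fold (λ F F' → CliqueMembers G F → CliqueMembers G F') (λ r rest → rest ∘ R1-preserves-cliques r) id

hitBy : ∀ {n} → Fam n → Fin n × Fin n → Fam n
hitBy F (u , v) Z = not ⌊ u ≟ v ⌋ ∧ containing F (pairSet u v) Z

hitBy⁺ : ∀ {n} (F : Fam n) (e : Fin n × Fin n) (Z : Subset n) → T (F Z) → E Z e → T (hitBy F e Z)
hitBy⁺ F (u , v) Z m (u∈Z , v∈Z , u≢v) =
  from T-∧ (fromWitnessFalse {a? = u ≟ v} u≢v , containing⁺ F (pairSet u v) Z (pairSet⊆ u∈Z v∈Z) m)

hitBy⁻ : ∀ {n} (F : Fam n) (u v : Fin n) (Z : Subset n) → T (hitBy F (u , v) Z) →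
         u ≢ v × u ∈ Z × v ∈ Z × T (F Z)
hitBy⁻ F u v Z hit with to (T-∧ {not ⌊ u ≟ v ⌋}) hit
... | distinct , contains with containing⁻ F (pairSet u v) Z contains
... | uv⊆Z , m = toWitnessFalse distinct , uv⊆Z (u∈pairSet u v) , uv⊆Z (v∈pairSet u v) , m

-- In a family of cliques on which (R1) is inapplicable, each pair hits at
-- most 2·(t-2)!·k^(t-2) members: if it hits one, it is an edge, and the
-- members it hits embed into the link of that edge, which is 𝓕_uv.
pair-bound : ∀ {n} {G : Graph n} {t k : ℕ} {F : Fam n} →
             CliqueMembers G F → R1-inapplicable G t k F →
             ∀ e → count (hitBy F e) ≤ bound t k
pair-bound {t = t} {k} {F} cliques stuck (u , v) = count-cases (hitBy F (u , v)) λ (Z , hit) →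
  let (u≢v , u∈Z , v∈Z , m) = hitBy⁻ F u v Z hit
      uv∈G = cliques Z m u v u∈Z v∈Z u≢v
  in begin
    count (hitBy F (u , v))             ≤⟨ count-mono (hitBy F (u , v)) (containing F (pairSet u v))
                                             (λ Z → proj₂ ∘ to (T-∧ {not ⌊ u ≟ v ⌋})) ⟩
    count (containing F (pairSet u v))  ≤⟨ containing≤link F (pairSet u v) ⟩
    count (link F (pairSet u v))        ≤⟨ count-mono (link F (pairSet u v)) (Fxy F u v) (link⊆Fxy F u v) ⟩
    count (Fxy F u v)                   ≤⟨ stuck u v uv∈G ⟩
    bound t k                           ∎

count-any : ∀ {n} {I : Set} (P : I → Fam n) {b : ℕ} (S : List I) →
            All (λ i → count (P i) ≤ b) S → count (λ Z → any (λ i → P i Z) S) ≤ length S * b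
count-any P []      []       = ≤-reflexive (count-empty (λ Z → any (λ i → P i Z) []) λ _ ())
count-any P (i ∷ S) (bᵢ ∷ bs) =
  ≤-trans (count-∨ (P i) (λ Z → any (λ i → P i Z) S)) (+-mono-≤ bᵢ (count-any P S bs))

hitting-set-bound : ∀ {n} {F : Fam n} {b : ℕ} (S : List (Fin n × Fin n)) → HittingSet S F →
                    All (λ e → count (hitBy F e) ≤ b) S → card F ≤ length S * b
hitting-set-bound {F = F} {b} S hits bounds = begin
  card F                                    ≤⟨ count-mono F (λ Z → any (λ e → hitBy F e Z) S) covered ⟩
  count (λ Z → any (λ e → hitBy F e Z) S)   ≤⟨ count-any (hitBy F) S bounds ⟩
  length S * b                              ∎
  where
  covered : ∀ Z → T (F Z) → T (any (λ e → hitBy F e Z) S)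
  covered Z m with hits Z m
  ... | e , e∈S , e∈E-Z = any⁺ (λ e → hitBy F e Z) (Any.map (λ { refl → hitBy⁺ F e Z m e∈E-Z }) e∈S)

-- For k = 0 the candidate is empty; for k ≥ 1 all members are
-- cliques, so 'pair-bound' applies.
stable-pair-bounds : ∀ {n} {G : Graph n} {t k : ℕ} {F₀ F' : Fam n} →
                     CliqueFamily G t F₀ → Star (R1 G t k) F₀ F' → R1-inapplicable G t k F' →
                     (S : List (Fin n × Fin n)) → length S ≤ k →
                     All (λ e → count (hitBy F' e) ≤ bound t k) S
stable-pair-bounds {k = zero}  _      _   _     []  _ = []
stable-pair-bounds {G = G} {t} {suc k} {F₀} {F'} family run stuck S _ =
  tabulate λ {e} _ → pair-bound {G = G} {t} {suc k} {F'} (run-preserves-cliques run initial-cliques) stuck e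
  where
  initial-cliques : CliqueMembers G F₀
  initial-cliques Z m = proj₁ (to (family Z) m)

k*bound : ∀ t k → 2 ≤ t → k * bound t k ≡ 2 * (t ∸ 2) ! * k ^ (t ∸ 1)
k*bound (suc (suc m)) k (s≤s (s≤s _)) = rearrange (m !) k (k ^ m)
  where
  rearrange : ∀ a k c → k * (2 * a * c) ≡ 2 * a * (k * c)
  rearrange = solve-∀

lemma3 : ∀ {n} (G : Graph n) (t k : ℕ) → 2 ≤ t →
         (F₀ F' : Fam n) → CliqueFamily G t F₀ →
         Star (R1 G t k) F₀ F' → R1-inapplicable G t k F' →
         2 * (t ∸ 2) ! * k ^ (t ∸ 1) < card F' →
         (S : List (Fin n × Fin n)) → length S ≤ k → ¬ HittingSet S F'
lemma3 G t k 2≤t F₀ F' family run stuck large S |S|≤k hits = <⇒≱ large (begin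
  card F'                      ≤⟨ hitting-set-bound S hits (stable-pair-bounds family run stuck S |S|≤k) ⟩
  length S * bound t k         ≤⟨ *-monoˡ-≤ (bound t k) |S|≤k ⟩
  k * bound t k                ≡⟨ k*bound t k 2≤t ⟩
  2 * (t ∸ 2) ! * k ^ (t ∸ 1)  ∎)
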